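{- Let $n\in\mathbb{Z}^+$ and let $i_n(x):=x\vee x^{\ell\ell}\vee\cdots\vee x^{\ell^{2n-2}}$ (join of the even iterated left inverses $x^{\ell^{2k}}$, $0\le k\le n-1$). For every $n$-periodic $\ell$-pregroup $\mathbf{A}$: (1) the invertible elements of $\mathbf{A}$ are exactly the elements of the form $i_n(a)$ with $a\in A$; (2) the invertible elements of $\mathbf{A}$ commute with each other iff $\mathbf{A}$ satisfies the equation $i_n(x)i_n(y)=i_n(y)i_n(x)$. Moreover, (3) the equation $i_n(x)i_n(y)=i_n(y)i_n(x)$ holds in $\mathbf{F}_n(\mathbb{Z})$ but fails in $\mathsf{LP_n}$.
   Context: An $\ell$-pregroup is an algebra $(A,\wedge,\vee,\cdot,{}^{\ell},{}^{r},1)$ with lattice reduct, monoid reduct, order-preserving multiplication, and $x^{\ell}x\le 1\le xx^{\ell}$, $xx^{r}\le 1\le x^{r}x$; it is $n$-periodic if it satisfies $x^{\ell^n}=x^{r^n}$; $\mathsf{LP_n}$ is the variety of $n$-periodic $\ell$-pregroups. An element is invertible if it has a two-sided multiplicative inverse. $\mathbf{F}_n(\mathbb{Z})$ is the $\ell$-pregroup of maps $f$ on $\mathbb{Z}$ that have residuals ($f^r(b)=\max\{a:f(a)\le b\}$) and dual residuals ($f^\ell(a)=\min\{b:a\le f(b)\}$) of all orders and satisfy $f^{\ell^n}=f^{r^n}$, under composition, identity, pointwise order, ${}^\ell,{}^r$. -}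

module Defs where

open import Level using (Level) renaming (suc to lsuc)
open import Data.Nat using (ℕ; zero; suc; _+_; _*_)
open import Data.Integer as ℤ using (ℤ)
open import Data.Product using (Σ; ∃; _×_; _,_)
open import Relation.Binary.PropositionalEquality using (_≡_)
open import Algebra.Core using (Op₁; Op₂)
open import Algebra.Structures using (IsMonoid)
open import Algebra.Lattice.Structures using (IsLattice)

record LPregroup (c : Level) : Set (lsuc c) where
  infixl 7 _·_
  infixr 6 _∨_
  infixr 7 _∧_
  infix 4 _≤_
  field
    Carrier   : Set c
    _∧_       : Op₂ Carrier
    _∨_       : Op₂ Carrier
    _·_       : Op₂ Carrier
    _ˡ        : Op₁ Carrier
    _ʳ        : Op₁ Carrier
    1#        : Carrier
    isLattice : IsLattice _≡_ _∨_ _∧_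
    isMonoid  : IsMonoid _≡_ _·_ 1#

  _≤_ : Carrier → Carrier → Set c
  x ≤ y = x ∧ y ≡ x

  field
    ·-monoˡ : ∀ {x y} z → x ≤ y → z · x ≤ z · y
    ·-monoʳ : ∀ {x y} z → x ≤ y → x · z ≤ y · z
    ˡ-contract : ∀ x → (x ˡ) · x ≤ 1#
    ˡ-expand   : ∀ x → 1# ≤ x · (x ˡ)
    ʳ-contract : ∀ x → x · (x ʳ) ≤ 1#
    ʳ-expand   : ∀ x → 1# ≤ (x ʳ) · x

module _ {c : Level} (A : LPregroup c) where
  open LPregroup A

  ℓ^ : ℕ → Carrier → Carrier
  ℓ^ zero    x = x
  ℓ^ (suc k) x = (ℓ^ k x) ˡ

  r^ : ℕ → Carrier → Carrier
  r^ zero    x = x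
  r^ (suc k) x = (r^ k x) ʳ

  Periodic : ℕ → Set c
  Periodic n = ∀ x → ℓ^ n x ≡ r^ n x

  Invertible : Carrier → Set c
  Invertible x = Σ Carrier λ y → (x · y ≡ 1#) × (y · x ≡ 1#)

  -- iJoin m x = x ∨ x^{ℓℓ} ∨ ... ∨ x^{ℓ^{2m}}   (so i_n = iJoin (n-1))
  iJoin : ℕ → Carrier → Carrier
  iJoin zero    x = x
  iJoin (suc m) x = iJoin m x ∨ ℓ^ (2 * suc m) x

  -- i_n(x) for n ≥ 1; for n = 0 (not used) it is x
  i : ℕ → Carrier → Carrier
  i zero    x = x
  i (suc m) x = iJoin m x

  ICommutes : ℕ → Set c
  ICommutes n = ∀ x y → i n x · i n y ≡ i n y · i n x

  InvertiblesCommute : Set c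
  InvertiblesCommute =
    ∀ x y → Invertible x → Invertible y → x · y ≡ y · x

IsMax : (ℤ → Set) → ℤ → Set
IsMax P m = P m × (∀ a → P a → a ℤ.≤ m)

IsMin : (ℤ → Set) → ℤ → Set
IsMin P m = P m × (∀ b → P b → m ℤ.≤ b)

OrderPreserving : (ℤ → ℤ) → Set
OrderPreserving f = ∀ {a b} → a ℤ.≤ b → f a ℤ.≤ f b

IsResidual : (ℤ → ℤ) → (ℤ → ℤ) → Set
IsResidual f g = ∀ b → IsMax (λ a → f a ℤ.≤ b) (g b)

IsDualResidual : (ℤ → ℤ) → (ℤ → ℤ) → Set
IsDualResidual f g = ∀ a → IsMin (λ b → a ℤ.≤ f b) (g a)

-- An element of F_n(ℤ): an order-preserving map f together with its
-- iterated residuals  rs k = f^{r^k}  and dual residuals  ls k = f^{ℓ^k}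
-- (which exist for all k), satisfying f^{ℓ^n} = f^{r^n}.
record Fn (n : ℕ) : Set where
  field
    fun     : ℤ → ℤ
    mono    : OrderPreserving fun
    rs      : ℕ → ℤ → ℤ
    ls      : ℕ → ℤ → ℤ
    rs-zero : ∀ a → rs zero a ≡ fun a
    ls-zero : ∀ a → ls zero a ≡ fun a
    rs-suc  : ∀ k → IsResidual (rs k) (rs (suc k))
    ls-suc  : ∀ k → IsDualResidual (ls k) (ls (suc k))
    periodic : ∀ a → ls n a ≡ rs n a

iJoinF : ∀ {n} → ℕ → Fn n → ℤ → ℤ
iJoinF zero    f a = Fn.ls f zero a
iJoinF (suc m) f a = iJoinF m f a ℤ.⊔ Fn.ls f (2 * suc m) a

iF : ∀ {n} → Fn n → ℤ → ℤ
iF {zero}  f = Fn.fun f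
iF {suc m} f = iJoinF m f

-- the equation i_n(x) i_n(y) = i_n(y) i_n(x) holds in F_n(ℤ)
-- (multiplication is composition; equality of maps is pointwise)
ICommutesF : ℕ → Set
ICommutesF n = ∀ (f g : Fn n) a → iF f (iF g a) ≡ iF g (iF f a)

-- Invertible elements are exactly the x with x^{ℓℓ} = x (then x^ℓ = x^r is the inverse).
-- Since x ↦ x^{ℓℓ} preserves joins and n-periodicity gives x^{ℓ^{2n}} = x, applying ℓℓ to
-- i_n(a) permutes its joinands cyclically, so i_n(a) is invertible, while an invertible x
-- is i_n(x); (2) follows. In F_n(ℤ) the dual residuals make each f^{ℓ^{k+1}} left adjoint to
-- f^{ℓ^k}, so the join i_n(f) of the even iterates and the meet of the odd ones are adjoint to
-- each other on both sides: i_n(f) is an order automorphism of ℤ, i.e. a translation, and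
-- translations commute. The Heisenberg group ordered lexicographically is a noncommutative
-- totally ordered group, hence an n-periodic ℓ-pregroup with x^ℓ = x^r = x⁻¹ in which every
-- element is invertible; by (2) the equation fails there.

module Submission where

open import Defs
open import Level using (Level) renaming (zero to 0ℓ)
open import Data.Nat using (ℕ; suc)
open import Data.Product using (Σ; ∃; _×_; _,_)
open import Function.Bundles using (_⇔_)
open import Relation.Binary.PropositionalEquality using (_≡_)
open import Relation.Nullary using (¬_)
open import Data.Nat using (zero)
import Data.Nat as ℕ
import Data.Nat.Properties as ℕ
import Data.Integer.Properties as ℤ
open import Data.Product using (proj₁; proj₂)
open import Data.Sum using (_⊎_; inj₁; inj₂)
open import Data.List using (_∷_; [])
open import Function.Bundles using (mk⇔; Equivalence)
open import Relation.Binary.Core using (Rel)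
open import Relation.Binary.Bundles using (TotalOrder)
open import Relation.Binary.Structures using (IsTotalOrder)
open import Relation.Binary.Definitions using (tri<; tri≈; tri>)
open import Relation.Binary.PropositionalEquality
  using (_≢_; _≗_; refl; sym; trans; cong; cong₂; subst; subst₂; isEquivalence; module ≡-Reasoning)
open import Relation.Nullary using (contradiction)
open import Algebra.Core using (Op₁; Op₂)
open import Algebra.Structures using (IsMonoid; IsGroup)
open import Algebra.Lattice.Structures using (IsLattice)
import Algebra.Lattice.Properties.Lattice as LatticeProperties
import Algebra.Construct.NaturalChoice.Min as Min
import Algebra.Construct.NaturalChoice.Max as Max
import Algebra.Lattice.Construct.NaturalChoice.MinMaxOp as MinMaxOp
import Relation.Binary.Lattice as OrderLattice
import Relation.Binary.Lattice.Properties.JoinSemilattice as JoinSemilatticeProperties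
import Relation.Binary.Reasoning.PartialOrder as ≤-Reasoning

module LPregroupProperties {c : Level} (A : LPregroup c) where

  open import Data.Nat using (_+_; _*_)

  open LPregroup A hiding (_≤_)
  open IsLattice isLattice using (∨-comm; ∨-assoc)
  open IsMonoid isMonoid using (assoc; identityˡ; identityʳ)

  -- The standard library orders a lattice by x ≡ x ∧ y; LPregroup uses x ∧ y ≡ x.
  orderLattice : OrderLattice.Lattice c c c
  orderLattice = LatticeProperties.∨-∧-orderTheoreticLattice (record { isLattice = isLattice })

  open OrderLattice.Lattice orderLattice
    using (_≤_; poset; x≤x∨y; y≤x∨y; ∨-least; x∧y≤x; x∧y≤y; ∧-greatest)
    renaming (refl to ≤-refl; reflexive to ≤-reflexive; trans to ≤-trans; antisym to ≤-antisym)
  open JoinSemilatticeProperties (OrderLattice.Lattice.joinSemilattice orderLattice)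
    using (x≤y⇒x∨y≈y)
  open ≤-Reasoning poset

  fromLPregroup≤ : ∀ {x y} → LPregroup._≤_ A x y → x ≤ y
  fromLPregroup≤ = sym

  ·-monoˡ-≤ : ∀ z {x y} → x ≤ y → z · x ≤ z · y
  ·-monoˡ-≤ z x≤y = sym (·-monoˡ z (sym x≤y))

  ·-monoʳ-≤ : ∀ z {x y} → x ≤ y → x · z ≤ y · z
  ·-monoʳ-≤ z x≤y = sym (·-monoʳ z (sym x≤y))

  ≤ˡ : ∀ {a b} → a · b ≤ 1# → a ≤ b ˡ
  ≤ˡ {a} {b} ab≤1 = begin
    a                ≈⟨ identityʳ a ⟨
    a · 1#           ≤⟨ ·-monoˡ-≤ a (fromLPregroup≤ (ˡ-expand b)) ⟩
    a · (b · b ˡ)    ≈⟨ assoc a b (b ˡ) ⟨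
    a · b · b ˡ      ≤⟨ ·-monoʳ-≤ (b ˡ) ab≤1 ⟩
    1# · b ˡ         ≈⟨ identityˡ (b ˡ) ⟩
    b ˡ              ∎

  ˡ≤ : ∀ {a b} → 1# ≤ b · a → b ˡ ≤ a
  ˡ≤ {a} {b} 1≤ba = begin
    b ˡ              ≈⟨ identityʳ (b ˡ) ⟨
    b ˡ · 1#         ≤⟨ ·-monoˡ-≤ (b ˡ) 1≤ba ⟩
    b ˡ · (b · a)    ≈⟨ assoc (b ˡ) b a ⟨
    b ˡ · b · a      ≤⟨ ·-monoʳ-≤ a (fromLPregroup≤ (ˡ-contract b)) ⟩
    1# · a           ≈⟨ identityˡ a ⟩
    a                ∎

  ≤ʳ : ∀ {a b} → a · b ≤ 1# → b ≤ a ʳ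
  ≤ʳ {a} {b} ab≤1 = begin
    b                ≈⟨ identityˡ b ⟨
    1# · b           ≤⟨ ·-monoʳ-≤ b (fromLPregroup≤ (ʳ-expand a)) ⟩
    a ʳ · a · b      ≈⟨ assoc (a ʳ) a b ⟩
    a ʳ · (a · b)    ≤⟨ ·-monoˡ-≤ (a ʳ) ab≤1 ⟩
    a ʳ · 1#         ≈⟨ identityʳ (a ʳ) ⟩
    a ʳ              ∎

  ʳ≤ : ∀ {a b} → 1# ≤ b · a → a ʳ ≤ b
  ʳ≤ {a} {b} 1≤ba = begin
    a ʳ              ≈⟨ identityˡ (a ʳ) ⟨
    1# · a ʳ         ≤⟨ ·-monoʳ-≤ (a ʳ) 1≤ba ⟩
    b · a · a ʳ      ≈⟨ assoc b a (a ʳ) ⟩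
    b · (a · a ʳ)    ≤⟨ ·-monoˡ-≤ b (fromLPregroup≤ (ʳ-contract a)) ⟩
    b · 1#           ≈⟨ identityʳ b ⟩
    b                ∎

  ˡ-unique : ∀ {a b} → a · b ≤ 1# → 1# ≤ b · a → a ≡ b ˡ
  ˡ-unique ab≤1 1≤ba = ≤-antisym (≤ˡ ab≤1) (ˡ≤ 1≤ba)

  ʳ-unique : ∀ {a b} → a · b ≤ 1# → 1# ≤ b · a → b ≡ a ʳ
  ʳ-unique ab≤1 1≤ba = ≤-antisym (≤ʳ ab≤1) (ʳ≤ 1≤ba)

  ˡʳ-inverse : ∀ x → (x ˡ) ʳ ≡ x
  ˡʳ-inverse x = sym (ʳ-unique (fromLPregroup≤ (ˡ-contract x)) (fromLPregroup≤ (ˡ-expand x)))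

  ʳˡ-inverse : ∀ x → (x ʳ) ˡ ≡ x
  ʳˡ-inverse x = sym (ˡ-unique (fromLPregroup≤ (ʳ-contract x)) (fromLPregroup≤ (ʳ-expand x)))

  ˡ-antitone : ∀ {x y} → x ≤ y → y ˡ ≤ x ˡ
  ˡ-antitone {x} {y} x≤y =
    ≤ˡ (≤-trans (·-monoˡ-≤ (y ˡ) x≤y) (fromLPregroup≤ (ˡ-contract y)))

  ʳ-antitone : ∀ {x y} → x ≤ y → y ʳ ≤ x ʳ
  ʳ-antitone {x} {y} x≤y =
    ≤ʳ (≤-trans (·-monoʳ-≤ (y ʳ) x≤y) (fromLPregroup≤ (ʳ-contract y)))

  ˡ-∨ : ∀ x y → (x ∨ y) ˡ ≡ x ˡ ∧ y ˡ
  ˡ-∨ x y = ≤-antisym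
    (∧-greatest (ˡ-antitone (x≤x∨y x y)) (ˡ-antitone (y≤x∨y x y)))
    (begin
      x ˡ ∧ y ˡ            ≈⟨ ʳˡ-inverse (x ˡ ∧ y ˡ) ⟨
      ((x ˡ ∧ y ˡ) ʳ) ˡ    ≤⟨ ˡ-antitone (∨-least (below x (x∧y≤x _ _)) (below y (x∧y≤y _ _))) ⟩
      (x ∨ y) ˡ            ∎)
    where
    below : ∀ z {w} → w ≤ z ˡ → z ≤ w ʳ
    below z w≤zˡ = ≤-trans (≤-reflexive (sym (ˡʳ-inverse z))) (ʳ-antitone w≤zˡ)

  ˡ-∧ : ∀ x y → (x ∧ y) ˡ ≡ x ˡ ∨ y ˡ
  ˡ-∧ x y = ≤-antisym
    (begin
      (x ∧ y) ˡ            ≤⟨ ˡ-antitone (∧-greatest (above x (x≤x∨y _ _)) (above y (y≤x∨y _ _))) ⟩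
      ((x ˡ ∨ y ˡ) ʳ) ˡ    ≈⟨ ʳˡ-inverse (x ˡ ∨ y ˡ) ⟩
      x ˡ ∨ y ˡ            ∎)
    (∨-least (ˡ-antitone (x∧y≤x x y)) (ˡ-antitone (x∧y≤y x y)))
    where
    above : ∀ z {w} → z ˡ ≤ w → w ʳ ≤ z
    above z zˡ≤w = ≤-trans (ʳ-antitone zˡ≤w) (≤-reflexive (ˡʳ-inverse z))

  ˡˡ-∨ : ∀ x y → ((x ∨ y) ˡ) ˡ ≡ (x ˡ) ˡ ∨ (y ˡ) ˡ
  ˡˡ-∨ x y = trans (cong _ˡ (ˡ-∨ x y)) (ˡ-∧ (x ˡ) (y ˡ))

  invertible⇒ˡˡ-fixed : ∀ {x} → Invertible A x → (x ˡ) ˡ ≡ x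
  invertible⇒ˡˡ-fixed {x} (y , xy≡1 , yx≡1) = begin-equality
    (x ˡ) ˡ  ≡⟨ cong _ˡ (ˡ-unique (≤-reflexive yx≡1) (≤-reflexive (sym xy≡1))) ⟨
    y ˡ      ≡⟨ ˡ-unique (≤-reflexive xy≡1) (≤-reflexive (sym yx≡1)) ⟨
    x        ∎

  ˡˡ-fixed⇒invertible : ∀ {x} → (x ˡ) ˡ ≡ x → Invertible A x
  ˡˡ-fixed⇒invertible {x} xˡˡ≡x =
    x ˡ , ≤-antisym (subst (λ y → x · y ≤ 1#) xʳ≡xˡ (fromLPregroup≤ (ʳ-contract x)))
                    (fromLPregroup≤ (ˡ-expand x))
        , ≤-antisym (fromLPregroup≤ (ˡ-contract x))
                    (subst (λ y → 1# ≤ y · x) xʳ≡xˡ (fromLPregroup≤ (ʳ-expand x)))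
    where
    xʳ≡xˡ : x ʳ ≡ x ˡ
    xʳ≡xˡ = trans (cong _ʳ (sym xˡˡ≡x)) (ˡʳ-inverse (x ˡ))

  ℓ^-suc : ∀ k x → ℓ^ A (suc k) x ≡ ℓ^ A k (x ˡ)
  ℓ^-suc zero    x = refl
  ℓ^-suc (suc k) x = cong _ˡ (ℓ^-suc k x)

  ℓ^-+ : ∀ j k x → ℓ^ A (j + k) x ≡ ℓ^ A j (ℓ^ A k x)
  ℓ^-+ zero    k x = refl
  ℓ^-+ (suc j) k x = cong _ˡ (ℓ^-+ j k x)

  ℓ^-r^-inverse : ∀ k x → ℓ^ A k (r^ A k x) ≡ x
  ℓ^-r^-inverse zero    x = refl
  ℓ^-r^-inverse (suc k) x = begin-equality
    ℓ^ A (suc k) (r^ A k x ʳ)    ≡⟨ ℓ^-suc k (r^ A k x ʳ) ⟩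
    ℓ^ A k ((r^ A k x ʳ) ˡ)      ≡⟨ cong (ℓ^ A k) (ʳˡ-inverse (r^ A k x)) ⟩
    ℓ^ A k (r^ A k x)            ≡⟨ ℓ^-r^-inverse k x ⟩
    x                            ∎

  ℓ^-2*suc : ∀ k x → ℓ^ A (2 * suc k) x ≡ (ℓ^ A (2 * k) x ˡ) ˡ
  ℓ^-2*suc k x = cong (λ j → ℓ^ A j x) (ℕ.*-suc 2 k)

  periodic⇒ℓ^-2*n : ∀ n → Periodic A n → ∀ x → ℓ^ A (2 * n) x ≡ x
  periodic⇒ℓ^-2*n n periodic x = begin-equality
    ℓ^ A (2 * n) x        ≡⟨ cong (λ k → ℓ^ A (n + k) x) (ℕ.+-identityʳ n) ⟩
    ℓ^ A (n + n) x        ≡⟨ ℓ^-+ n n x ⟩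
    ℓ^ A n (ℓ^ A n x)     ≡⟨ cong (ℓ^ A n) (periodic x) ⟩
    ℓ^ A n (r^ A n x)     ≡⟨ ℓ^-r^-inverse n x ⟩
    x                     ∎

  ˡˡ-fixed⇒ℓ^-2*k : ∀ {x} → (x ˡ) ˡ ≡ x → ∀ k → ℓ^ A (2 * k) x ≡ x
  ˡˡ-fixed⇒ℓ^-2*k xˡˡ≡x zero    = refl
  ˡˡ-fixed⇒ℓ^-2*k xˡˡ≡x (suc k) =
    trans (ℓ^-2*suc k _) (trans (cong (λ y → (y ˡ) ˡ) (ˡˡ-fixed⇒ℓ^-2*k xˡˡ≡x k)) xˡˡ≡x)

  ˡˡ-fixed⇒iJoin-fixed : ∀ {x} → (x ˡ) ˡ ≡ x → ∀ j → iJoin A j x ≡ x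
  ˡˡ-fixed⇒iJoin-fixed xˡˡ≡x zero    = refl
  ˡˡ-fixed⇒iJoin-fixed xˡˡ≡x (suc j) =
    trans (cong₂ _∨_ (ˡˡ-fixed⇒iJoin-fixed xˡˡ≡x j) (ˡˡ-fixed⇒ℓ^-2*k xˡˡ≡x (suc j)))
          (x≤y⇒x∨y≈y ≤-refl)

  x≤iJoin : ∀ j x → x ≤ iJoin A j x
  x≤iJoin zero    x = ≤-refl
  x≤iJoin (suc j) x = ≤-trans (x≤iJoin j x) (x≤x∨y _ _)

  ℓ^-2*j≤iJoin : ∀ j x → ℓ^ A (2 * j) x ≤ iJoin A j x
  ℓ^-2*j≤iJoin zero    x = ≤-refl
  ℓ^-2*j≤iJoin (suc j) x = y≤x∨y _ _

  iJoin-ˡˡ : ∀ j x → x ∨ (iJoin A j x ˡ) ˡ ≡ iJoin A (suc j) x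
  iJoin-ˡˡ zero    x = cong (x ∨_) (sym (ℓ^-2*suc 0 x))
  iJoin-ˡˡ (suc j) x = begin-equality
    x ∨ ((iJoin A j x ∨ ℓ^ A (2 * suc j) x) ˡ) ˡ
      ≡⟨ cong (x ∨_) (ˡˡ-∨ (iJoin A j x) _) ⟩
    x ∨ ((iJoin A j x ˡ) ˡ ∨ (ℓ^ A (2 * suc j) x ˡ) ˡ)
      ≡⟨ ∨-assoc x _ _ ⟨
    (x ∨ (iJoin A j x ˡ) ˡ) ∨ (ℓ^ A (2 * suc j) x ˡ) ˡ
      ≡⟨ cong₂ _∨_ (iJoin-ˡˡ j x) (sym (ℓ^-2*suc (suc j) x)) ⟩
    iJoin A (suc (suc j)) x
      ∎

  iJoin-ˡˡ-fixed : ∀ m → Periodic A (suc m) → ∀ a → (iJoin A m a ˡ) ˡ ≡ iJoin A m a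
  iJoin-ˡˡ-fixed m periodic a = begin-equality
    (h ˡ) ˡ                     ≡⟨ x≤y⇒x∨y≈y a≤hˡˡ ⟨
    a ∨ (h ˡ) ˡ                 ≡⟨ iJoin-ˡˡ m a ⟩
    h ∨ ℓ^ A (2 * suc m) a      ≡⟨ cong (h ∨_) (periodic⇒ℓ^-2*n (suc m) periodic a) ⟩
    h ∨ a                       ≡⟨ ∨-comm h a ⟩
    a ∨ h                       ≡⟨ x≤y⇒x∨y≈y (x≤iJoin m a) ⟩
    h                           ∎
    where
    h = iJoin A m a
    a≤hˡˡ : a ≤ (h ˡ) ˡ
    a≤hˡˡ = begin
      a                              ≈⟨ periodic⇒ℓ^-2*n (suc m) periodic a ⟨
      ℓ^ A (2 * suc m) a             ≈⟨ ℓ^-2*suc m a ⟩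
      (ℓ^ A (2 * m) a ˡ) ˡ           ≤⟨ ˡ-antitone (ˡ-antitone (ℓ^-2*j≤iJoin m a)) ⟩
      (h ˡ) ˡ                        ∎

  invertible⇔i-image : ∀ m → Periodic A (suc m) →
    ∀ x → Invertible A x ⇔ Σ Carrier (λ a → x ≡ i A (suc m) a)
  invertible⇔i-image m periodic x = mk⇔
    (λ inv → x , sym (ˡˡ-fixed⇒iJoin-fixed (invertible⇒ˡˡ-fixed inv) m))
    (λ { (a , refl) → ˡˡ-fixed⇒invertible (iJoin-ˡˡ-fixed m periodic a) })

  invertiblesCommute⇔ICommutes : ∀ m → Periodic A (suc m) →
    InvertiblesCommute A ⇔ ICommutes A (suc m)
  invertiblesCommute⇔ICommutes m periodic = mk⇔
    (λ comm a b → comm _ _ (from (a , refl)) (from (b , refl)))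
    (λ icomm x y x-inv y-inv → commute icomm (to x-inv) (to y-inv))
    where
    open module Image {x} = Equivalence (invertible⇔i-image m periodic x)
    commute : ∀ {x y} → ICommutes A (suc m) → Σ Carrier (λ a → x ≡ i A (suc m) a) →
              Σ Carrier (λ b → y ≡ i A (suc m) b) → x · y ≡ y · x
    commute icomm (a , refl) (b , refl) = icomm a b

module IntegerMaps where

  open import Data.Integer as ℤ using (ℤ; _≤_; _⊔_; _⊓_; _+_; +_; -[1+_]; 0ℤ; 1ℤ)
  open import Data.Nat.Tactic.RingSolver using (solve-∀)

  open Equivalence using (to; from)

  infix 4 _⊣_

  _⊣_ : (ℤ → ℤ) → (ℤ → ℤ) → Set
  p ⊣ q = ∀ a b → p a ≤ b ⇔ a ≤ q b

  module _ {p q : ℤ → ℤ} (p⊣q : p ⊣ q) where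

    unit : ∀ a → a ≤ q (p a)
    unit a = to (p⊣q a (p a)) ℤ.≤-refl

    counit : ∀ b → p (q b) ≤ b
    counit b = from (p⊣q (q b) b) ℤ.≤-refl

    ⊣⇒monoˡ : OrderPreserving p
    ⊣⇒monoˡ {a} {a′} a≤a′ = from (p⊣q a (p a′)) (ℤ.≤-trans a≤a′ (unit a′))

    ⊣⇒monoʳ : OrderPreserving q
    ⊣⇒monoʳ {b} {b′} b≤b′ = to (p⊣q (q b) b′) (ℤ.≤-trans (counit b) b≤b′)

    ⊣-respˡ : ∀ {p′} → p ≗ p′ → p′ ⊣ q
    ⊣-respˡ p≗p′ a b = subst (λ x → x ≤ b ⇔ a ≤ q b) (p≗p′ a) (p⊣q a b)

    ⊣-respʳ : ∀ {q′} → q ≗ q′ → p ⊣ q′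
    ⊣-respʳ q≗q′ a b = subst (λ y → p a ≤ b ⇔ a ≤ y) (q≗q′ b) (p⊣q a b)

  ⊣-unique : ∀ {p q p′ q′} → p ⊣ q → p′ ⊣ q′ → q ≗ q′ → p ≗ p′
  ⊣-unique p⊣q p′⊣q′ q≗q′ a = ℤ.≤-antisym
    (from (p⊣q a _) (subst (a ≤_) (sym (q≗q′ _)) (unit p′⊣q′ a)))
    (from (p′⊣q′ a _) (subst (a ≤_) (q≗q′ _) (unit p⊣q a)))

  residual⇒⊣ : ∀ {f g} → OrderPreserving f → IsResidual f g → f ⊣ g
  residual⇒⊣ {f} {g} f-mono g-residual a b = mk⇔
    (λ fa≤b → proj₂ (g-residual b) a fa≤b)
    (λ a≤gb → ℤ.≤-trans (f-mono a≤gb) (proj₁ (g-residual b)))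

  dualResidual⇒⊣ : ∀ {f g} → OrderPreserving f → IsDualResidual f g → g ⊣ f
  dualResidual⇒⊣ {f} {g} f-mono g-dualResidual a b = mk⇔
    (λ ga≤b → ℤ.≤-trans (proj₁ (g-dualResidual a)) (f-mono ga≤b))
    (λ a≤fb → proj₂ (g-dualResidual a) b a≤fb)

  -- ℤ is a chain, so a meet lies below b as soon as one of its arguments does.
  ⊓-⊣-⊔ : ∀ {p q p′ q′} → p ⊣ q → p′ ⊣ q′ → (λ a → p a ⊓ p′ a) ⊣ (λ b → q b ⊔ q′ b)
  ⊓-⊣-⊔ {p} {q} {p′} {q′} p⊣q p′⊣q′ a b = mk⇔ ⊓≤⇒≤⊔ ≤⊔⇒⊓≤
    where
    ⊓≤⇒≤⊔ : p a ⊓ p′ a ≤ b → a ≤ q b ⊔ q′ b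
    ⊓≤⇒≤⊔ ⊓≤b with ℤ.⊓-sel (p a) (p′ a)
    ... | inj₁ ⊓≡p  = ℤ.i≤j⇒i≤j⊔k (q′ b) (to (p⊣q a b) (subst (_≤ b) ⊓≡p ⊓≤b))
    ... | inj₂ ⊓≡p′ = ℤ.i≤j⇒i≤k⊔j (q b) (to (p′⊣q′ a b) (subst (_≤ b) ⊓≡p′ ⊓≤b))
    ≤⊔⇒⊓≤ : a ≤ q b ⊔ q′ b → p a ⊓ p′ a ≤ b
    ≤⊔⇒⊓≤ a≤⊔ with ℤ.⊔-sel (q b) (q′ b)
    ... | inj₁ ⊔≡q  = ℤ.i≤j⇒i⊓k≤j (p′ a) (from (p⊣q a b) (subst (a ≤_) ⊔≡q a≤⊔))
    ... | inj₂ ⊔≡q′ = ℤ.i≤j⇒k⊓i≤j (p a) (from (p′⊣q′ a b) (subst (a ≤_) ⊔≡q′ a≤⊔))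

  ⊔-⊣-⊓ : ∀ {p q p′ q′} → p ⊣ q → p′ ⊣ q′ → (λ a → p a ⊔ p′ a) ⊣ (λ b → q b ⊓ q′ b)
  ⊔-⊣-⊓ {p} {q} {p′} {q′} p⊣q p′⊣q′ a b = mk⇔
    (λ ⊔≤b → ℤ.⊓-glb (to (p⊣q a b) (ℤ.i⊔j≤k⇒i≤k (p a) (p′ a) ⊔≤b))
                     (to (p′⊣q′ a b) (ℤ.i⊔j≤k⇒j≤k (p a) (p′ a) ⊔≤b)))
    (λ a≤⊓ → ℤ.⊔-lub (from (p⊣q a b) (ℤ.i≤j⊓k⇒i≤j (q b) (q′ b) a≤⊓))
                     (from (p′⊣q′ a b) (ℤ.i≤j⊓k⇒i≤k (q b) (q′ b) a≤⊓)))

  module _ (L : ℕ → ℤ → ℤ) where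

    joinEveryOther : ℕ → ℕ → ℤ → ℤ
    joinEveryOther s zero    a = L s a
    joinEveryOther s (suc j) a = joinEveryOther s j a ⊔ L (s ℕ.+ 2 ℕ.* suc j) a

    meetEveryOther : ℕ → ℕ → ℤ → ℤ
    meetEveryOther s zero    a = L s a
    meetEveryOther s (suc j) a = meetEveryOther s j a ⊓ L (s ℕ.+ 2 ℕ.* suc j) a

    module _ (L-⊣ : ∀ k → L (suc k) ⊣ L k) where

      meetEveryOther-⊣ : ∀ s j → meetEveryOther (suc s) j ⊣ joinEveryOther s j
      meetEveryOther-⊣ s zero    = L-⊣ s
      meetEveryOther-⊣ s (suc j) = ⊓-⊣-⊔ (meetEveryOther-⊣ s j) (L-⊣ (s ℕ.+ 2 ℕ.* suc j))

      joinEveryOther-⊣ : ∀ s j → joinEveryOther (suc s) j ⊣ meetEveryOther s j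
      joinEveryOther-⊣ s zero    = L-⊣ s
      joinEveryOther-⊣ s (suc j) = ⊔-⊣-⊓ (joinEveryOther-⊣ s j) (L-⊣ (s ℕ.+ 2 ℕ.* suc j))

    joinEveryOther-peel : ∀ s j a →
      joinEveryOther s (suc j) a ≡ L s a ⊔ joinEveryOther (2 ℕ.+ s) j a
    joinEveryOther-peel s zero    a = cong (λ k → L s a ⊔ L k a) (ℕ.+-comm s 2)
    joinEveryOther-peel s (suc j) a = begin
      joinEveryOther s (suc j) a ⊔ L (s ℕ.+ 2 ℕ.* suc (suc j)) a
        ≡⟨ cong₂ _⊔_ (joinEveryOther-peel s j a) (cong (λ k → L k a) (index s j)) ⟩
      (L s a ⊔ joinEveryOther (2 ℕ.+ s) j a) ⊔ L (2 ℕ.+ s ℕ.+ 2 ℕ.* suc j) a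
        ≡⟨ ℤ.⊔-assoc (L s a) _ _ ⟩
      L s a ⊔ joinEveryOther (2 ℕ.+ s) (suc j) a
        ∎
      where
      open ≡-Reasoning
      index : ∀ s j → s ℕ.+ 2 ℕ.* suc (suc j) ≡ 2 ℕ.+ s ℕ.+ 2 ℕ.* suc j
      index = solve-∀

    joinEveryOther-rotate : ∀ s j → L (2 ℕ.+ s ℕ.+ 2 ℕ.* j) ≗ L s →
      joinEveryOther (2 ℕ.+ s) j ≗ joinEveryOther s j
    joinEveryOther-rotate s zero    wrap a =
      trans (cong (λ k → L k a) (sym (ℕ.+-identityʳ (2 ℕ.+ s)))) (wrap a)
    joinEveryOther-rotate s (suc j) wrap a = begin
      joinEveryOther (2 ℕ.+ s) j a ⊔ L (2 ℕ.+ s ℕ.+ 2 ℕ.* suc j) a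
        ≡⟨ cong (joinEveryOther (2 ℕ.+ s) j a ⊔_) (wrap a) ⟩
      joinEveryOther (2 ℕ.+ s) j a ⊔ L s a
        ≡⟨ ℤ.⊔-comm _ (L s a) ⟩
      L s a ⊔ joinEveryOther (2 ℕ.+ s) j a
        ≡⟨ joinEveryOther-peel s j a ⟨
      joinEveryOther s (suc j) a
        ∎
      where open ≡-Reasoning

  suc≰ : ∀ i → ¬ ℤ.suc i ≤ i
  suc≰ i suc[i]≤i = ℤ.<-irrefl refl (ℤ.suc[i]≤j⇒i<j suc[i]≤i)

  ≰⇒suc≤ : ∀ {i j} → ¬ j ≤ i → ℤ.suc i ≤ j
  ≰⇒suc≤ j≰i = ℤ.i<j⇒suc[i]≤j (ℤ.≰⇒> j≰i)

  -- Adjoint on both sides, h is an order automorphism of ℤ and so moves in unit steps.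
  mutual-⊣⇒suc-commute : ∀ {h h′} → h ⊣ h′ → h′ ⊣ h → ∀ a → h (ℤ.suc a) ≡ ℤ.suc (h a)
  mutual-⊣⇒suc-commute {h} {h′} h⊣h′ h′⊣h a = ℤ.≤-antisym upper lower
    where
    upper : h (ℤ.suc a) ≤ ℤ.suc (h a)
    upper = from (h⊣h′ _ _) (≰⇒suc≤ (λ h′[suc[ha]]≤a →
              suc≰ (h a) (to (h′⊣h _ _) h′[suc[ha]]≤a)))
    lower : ℤ.suc (h a) ≤ h (ℤ.suc a)
    lower = ≰⇒suc≤ (λ h[suc[a]]≤ha →
              suc≰ a (ℤ.≤-trans (to (h⊣h′ _ _) h[suc[a]]≤ha) (counit h′⊣h a)))

  module _ {h : ℤ → ℤ} (h-suc : ∀ a → h (ℤ.suc a) ≡ ℤ.suc (h a)) where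

    private
      step-up : ∀ a → h a ≡ a + h 0ℤ → h (ℤ.suc a) ≡ ℤ.suc a + h 0ℤ
      step-up a ha≡ = trans (h-suc a) (trans (cong ℤ.suc ha≡) (sym (ℤ.+-assoc 1ℤ a (h 0ℤ))))

      step-down : ∀ a → h (ℤ.suc a) ≡ ℤ.suc a + h 0ℤ → h a ≡ a + h 0ℤ
      step-down a hsa≡ = begin
        h a                        ≡⟨ ℤ.pred-suc (h a) ⟨
        ℤ.pred (ℤ.suc (h a))       ≡⟨ cong ℤ.pred (trans (sym (h-suc a)) hsa≡) ⟩
        ℤ.pred (ℤ.suc a + h 0ℤ)    ≡⟨ cong ℤ.pred (ℤ.+-assoc 1ℤ a (h 0ℤ)) ⟩
        ℤ.pred (ℤ.suc (a + h 0ℤ))  ≡⟨ ℤ.pred-suc (a + h 0ℤ) ⟩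
        a + h 0ℤ                   ∎
        where open ≡-Reasoning

    suc-commute⇒translation : ∀ a → h a ≡ a + h 0ℤ
    suc-commute⇒translation (+ zero)        = sym (ℤ.+-identityˡ (h 0ℤ))
    suc-commute⇒translation (+ suc n)       = step-up (+ n) (suc-commute⇒translation (+ n))
    suc-commute⇒translation -[1+ zero ]     = step-down -[1+ zero ] (suc-commute⇒translation (+ zero))
    suc-commute⇒translation -[1+ suc n ]    = step-down -[1+ suc n ] (suc-commute⇒translation -[1+ n ])

  translations-commute : ∀ {g h : ℤ → ℤ} → (∀ a → g a ≡ a + g 0ℤ) → (∀ a → h a ≡ a + h 0ℤ) →
    ∀ a → g (h a) ≡ h (g a)
  translations-commute {g} {h} g-transl h-transl a = begin
    g (h a)                ≡⟨ g-transl (h a) ⟩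
    h a + g 0ℤ             ≡⟨ cong (_+ g 0ℤ) (h-transl a) ⟩
    a + h 0ℤ + g 0ℤ        ≡⟨ ℤ.+-assoc a (h 0ℤ) (g 0ℤ) ⟩
    a + (h 0ℤ + g 0ℤ)      ≡⟨ cong (λ k → a + k) (ℤ.+-comm (h 0ℤ) (g 0ℤ)) ⟩
    a + (g 0ℤ + h 0ℤ)      ≡⟨ ℤ.+-assoc a (g 0ℤ) (h 0ℤ) ⟨
    a + g 0ℤ + h 0ℤ        ≡⟨ cong (_+ h 0ℤ) (g-transl a) ⟨
    g a + h 0ℤ             ≡⟨ h-transl (g a) ⟨
    h (g a)                ∎
    where open ≡-Reasoning

  OrderPreserving-resp : ∀ {f g} → f ≗ g → OrderPreserving f → OrderPreserving g
  OrderPreserving-resp {f} {g} f≗g f-mono {a} {b} a≤b =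
    subst₂ _≤_ (f≗g a) (f≗g b) (f-mono a≤b)

  module FnProperties {n : ℕ} (f : Fn n) where

    open Fn f

    ls-mono : ∀ k → OrderPreserving (ls k)
    ls-⊣ : ∀ k → ls (suc k) ⊣ ls k

    ls-mono zero    = OrderPreserving-resp (λ a → sym (ls-zero a)) mono
    ls-mono (suc k) = ⊣⇒monoˡ (ls-⊣ k)
    ls-⊣ k = dualResidual⇒⊣ (ls-mono k) (ls-suc k)

    rs-mono : ∀ k → OrderPreserving (rs k)
    rs-⊣ : ∀ k → rs k ⊣ rs (suc k)

    rs-mono zero    = OrderPreserving-resp (λ a → sym (rs-zero a)) mono
    rs-mono (suc k) = ⊣⇒monoʳ (rs-⊣ k)
    rs-⊣ k = residual⇒⊣ (rs-mono k) (rs-suc k)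

    -- f^{ℓ^{n+j+1}} and f^{r^k} are both left adjoint to f^{ℓ^{n+j}} = f^{r^{k+1}}.
    ls≗rs : ∀ j k → j ℕ.+ k ≡ n → ls (n ℕ.+ j) ≗ rs k
    ls≗rs zero    k refl a = trans (cong (λ i → ls i a) (ℕ.+-identityʳ k)) (periodic a)
    ls≗rs (suc j) k j+k≡n a = trans (cong (λ i → ls i a) (ℕ.+-suc n j))
      (⊣-unique (ls-⊣ (n ℕ.+ j)) (rs-⊣ k) (ls≗rs j (suc k) (trans (ℕ.+-suc j k) j+k≡n)) a)

    ls-2*n≗ls-0 : ls (2 ℕ.* n) ≗ ls 0
    ls-2*n≗ls-0 a = begin
      ls (n ℕ.+ (n ℕ.+ 0)) a  ≡⟨ cong (λ i → ls (n ℕ.+ i) a) (ℕ.+-identityʳ n) ⟩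
      ls (n ℕ.+ n) a          ≡⟨ ls≗rs n 0 (ℕ.+-identityʳ n) a ⟩
      rs 0 a                  ≡⟨ rs-zero a ⟩
      fun a                   ≡⟨ ls-zero a ⟨
      ls 0 a                  ∎
      where open ≡-Reasoning

  iJoinF≗joinEveryOther : ∀ {n} (f : Fn n) j → iJoinF j f ≗ joinEveryOther (Fn.ls f) 0 j
  iJoinF≗joinEveryOther f zero    a = refl
  iJoinF≗joinEveryOther f (suc j) a = cong (_⊔ Fn.ls f (2 ℕ.* suc j) a) (iJoinF≗joinEveryOther f j a)

  module IFAdjoints {m : ℕ} (f : Fn (suc m)) where

    open Fn f
    open FnProperties f

    iF′ : ℤ → ℤ
    iF′ = meetEveryOther ls 1 m

    iF′⊣iF : iF′ ⊣ iF f
    iF′⊣iF = ⊣-respʳ (meetEveryOther-⊣ ls ls-⊣ 0 m) (λ a → sym (iJoinF≗joinEveryOther f m a))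

    -- As f^{ℓ^{2n}} = f, the even iterates joined in i_n(f) may be taken from 2 to 2n instead.
    iF⊣iF′ : iF f ⊣ iF′
    iF⊣iF′ = ⊣-respˡ (joinEveryOther-⊣ ls ls-⊣ 1 m) (λ a → begin
      joinEveryOther ls 2 m a  ≡⟨ joinEveryOther-rotate ls 0 m wrap a ⟩
      joinEveryOther ls 0 m a  ≡⟨ iJoinF≗joinEveryOther f m a ⟨
      iF f a                   ∎)
      where
      open ≡-Reasoning
      wrap : ls (2 ℕ.+ 2 ℕ.* m) ≗ ls 0
      wrap a = trans (cong (λ i → ls i a) (sym (ℕ.*-suc 2 m))) (ls-2*n≗ls-0 a)

  iF-translation : ∀ {m} (f : Fn (suc m)) a → iF f a ≡ a + iF f 0ℤ
  iF-translation f = suc-commute⇒translation (mutual-⊣⇒suc-commute iF⊣iF′ iF′⊣iF)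
    where open IFAdjoints f

  iCommutesF : ∀ m → ICommutesF (suc m)
  iCommutesF m f g = translations-commute (iF-translation f) (iF-translation g)

module TotallyOrderedGroup
  {c} {G : Set c} {_∙_ : Op₂ G} {ε : G} {_⁻¹ : Op₁ G} {_≤_ : Rel G c}
  (isGroup : IsGroup _≡_ _∙_ ε _⁻¹) (isTotalOrder : IsTotalOrder _≡_ _≤_)
  (∙-monoˡ-≤ : ∀ z {x y} → x ≤ y → (z ∙ x) ≤ (z ∙ y))
  (∙-monoʳ-≤ : ∀ z {x y} → x ≤ y → (x ∙ z) ≤ (y ∙ z))
  where

  open IsGroup isGroup using (isMonoid; inverseˡ; inverseʳ)
  open IsTotalOrder isTotalOrder using (reflexive)

  totalOrder : TotalOrder c c c
  totalOrder = record { isTotalOrder = isTotalOrder }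

  open Min totalOrder using (_⊓_; minOperator; x≤y⇒x⊓y≈x; x⊓y≈x⇒x≤y)
  open Max totalOrder using (_⊔_; maxOperator)

  lPregroup : LPregroup c
  lPregroup = record
    { Carrier    = G
    ; _∧_        = _⊓_
    ; _∨_        = _⊔_
    ; _·_        = _∙_
    ; _ˡ         = _⁻¹
    ; _ʳ         = _⁻¹
    ; 1#         = ε
    ; isLattice  = MinMaxOp.⊔-⊓-isLattice minOperator maxOperator
    ; isMonoid   = isMonoid
    ; ·-monoˡ    = λ z x⊓y≡x → x≤y⇒x⊓y≈x (∙-monoˡ-≤ z (x⊓y≈x⇒x≤y x⊓y≡x))
    ; ·-monoʳ    = λ z x⊓y≡x → x≤y⇒x⊓y≈x (∙-monoʳ-≤ z (x⊓y≈x⇒x≤y x⊓y≡x))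
    ; ˡ-contract = λ x → x≤y⇒x⊓y≈x (reflexive (inverseˡ x))
    ; ˡ-expand   = λ x → x≤y⇒x⊓y≈x (reflexive (sym (inverseʳ x)))
    ; ʳ-contract = λ x → x≤y⇒x⊓y≈x (reflexive (inverseʳ x))
    ; ʳ-expand   = λ x → x≤y⇒x⊓y≈x (reflexive (sym (inverseˡ x)))
    }

  lPregroup-periodic : ∀ n → Periodic lPregroup n
  lPregroup-periodic zero    x = refl
  lPregroup-periodic (suc n) x = cong _⁻¹ (lPregroup-periodic n x)

  lPregroup-invertible : ∀ x → Invertible lPregroup x
  lPregroup-invertible x = x ⁻¹ , inverseʳ x , inverseˡ x

  noncommutative⇒¬ICommutes : ∀ x y → (x ∙ y) ≢ (y ∙ x) → ∀ m → ¬ ICommutes lPregroup (suc m)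
  noncommutative⇒¬ICommutes x y xy≢yx m icomm = xy≢yx
    (from icomm x y (lPregroup-invertible x) (lPregroup-invertible y))
    where
    open Equivalence (LPregroupProperties.invertiblesCommute⇔ICommutes lPregroup m
                        (lPregroup-periodic (suc m)))

module Heisenberg where

  open import Data.Integer using (ℤ; _+_; _*_; -_; _≤_; _<_; 0ℤ; 1ℤ)
  open import Data.Integer.Tactic.RingSolver using (solve)

  infixl 7 _∙_
  infix 4 _⊑_

  data H : Set where
    ⟨_,_,_⟩ : ℤ → ℤ → ℤ → H

  -- ⟨ a , b , c ⟩ is the unitriangular matrix [[1,a,c],[0,1,b],[0,0,1]].
  _∙_ : H → H → H
  ⟨ a , b , c ⟩ ∙ ⟨ a′ , b′ , c′ ⟩ = ⟨ a + a′ , b + b′ , c + c′ + a * b′ ⟩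

  ε : H
  ε = ⟨ 0ℤ , 0ℤ , 0ℤ ⟩

  _⁻¹ : H → H
  ⟨ a , b , c ⟩ ⁻¹ = ⟨ - a , - b , - c + a * b ⟩

  data _⊑_ : H → H → Set where
    <₁ : ∀ {a b c a′ b′ c′} → a < a′ → ⟨ a , b , c ⟩ ⊑ ⟨ a′ , b′ , c′ ⟩
    <₂ : ∀ {a b c b′ c′}    → b < b′ → ⟨ a , b , c ⟩ ⊑ ⟨ a , b′ , c′ ⟩
    ≤₃ : ∀ {a b c c′}       → c ≤ c′ → ⟨ a , b , c ⟩ ⊑ ⟨ a , b , c′ ⟩

  ⟨⟩-cong : ∀ {a b c a′ b′ c′} → a ≡ a′ → b ≡ b′ → c ≡ c′ → ⟨ a , b , c ⟩ ≡ ⟨ a′ , b′ , c′ ⟩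
  ⟨⟩-cong refl refl refl = refl

  isGroup : IsGroup _≡_ _∙_ ε _⁻¹
  isGroup = record
    { isMonoid = record
      { isSemigroup = record
        { isMagma = record { isEquivalence = isEquivalence ; ∙-cong = cong₂ _∙_ }
        ; assoc   = assoc
        }
      ; identity = identityˡ , identityʳ
      }
    ; inverse = inverseˡ , inverseʳ
    ; ⁻¹-cong = cong _⁻¹
    }
    where
    assoc : ∀ x y z → x ∙ y ∙ z ≡ x ∙ (y ∙ z)
    assoc ⟨ a , b , c ⟩ ⟨ a′ , b′ , c′ ⟩ ⟨ a″ , b″ , c″ ⟩ =
      ⟨⟩-cong (ℤ.+-assoc a a′ a″) (ℤ.+-assoc b b′ b″)
              (solve (a ∷ a′ ∷ b′ ∷ b″ ∷ c ∷ c′ ∷ c″ ∷ []))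
    identityˡ : ∀ x → ε ∙ x ≡ x
    identityˡ ⟨ a , b , c ⟩ = ⟨⟩-cong (ℤ.+-identityˡ a) (ℤ.+-identityˡ b) (solve (b ∷ c ∷ []))
    identityʳ : ∀ x → x ∙ ε ≡ x
    identityʳ ⟨ a , b , c ⟩ = ⟨⟩-cong (ℤ.+-identityʳ a) (ℤ.+-identityʳ b) (solve (a ∷ c ∷ []))
    inverseˡ : ∀ x → x ⁻¹ ∙ x ≡ ε
    inverseˡ ⟨ a , b , c ⟩ = ⟨⟩-cong (ℤ.+-inverseˡ a) (ℤ.+-inverseˡ b) (solve (a ∷ b ∷ c ∷ []))
    inverseʳ : ∀ x → x ∙ x ⁻¹ ≡ ε
    inverseʳ ⟨ a , b , c ⟩ = ⟨⟩-cong (ℤ.+-inverseʳ a) (ℤ.+-inverseʳ b) (solve (a ∷ b ∷ c ∷ []))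

  ⊑-refl : ∀ {x} → x ⊑ x
  ⊑-refl {⟨ a , b , c ⟩} = ≤₃ ℤ.≤-refl

  ⊑-trans : ∀ {x y z} → x ⊑ y → y ⊑ z → x ⊑ z
  ⊑-trans (<₁ p) (<₁ q) = <₁ (ℤ.<-trans p q)
  ⊑-trans (<₁ p) (<₂ q) = <₁ p
  ⊑-trans (<₁ p) (≤₃ q) = <₁ p
  ⊑-trans (<₂ p) (<₁ q) = <₁ q
  ⊑-trans (<₂ p) (<₂ q) = <₂ (ℤ.<-trans p q)
  ⊑-trans (<₂ p) (≤₃ q) = <₂ p
  ⊑-trans (≤₃ p) (<₁ q) = <₁ q
  ⊑-trans (≤₃ p) (<₂ q) = <₂ q
  ⊑-trans (≤₃ p) (≤₃ q) = ≤₃ (ℤ.≤-trans p q)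

  ⊑-antisym : ∀ {x y} → x ⊑ y → y ⊑ x → x ≡ y
  ⊑-antisym (<₁ p) (<₁ q) = contradiction q (ℤ.<-asym p)
  ⊑-antisym (<₁ p) (<₂ q) = contradiction p (ℤ.<-irrefl refl)
  ⊑-antisym (<₁ p) (≤₃ q) = contradiction p (ℤ.<-irrefl refl)
  ⊑-antisym (<₂ p) (<₁ q) = contradiction q (ℤ.<-irrefl refl)
  ⊑-antisym (<₂ p) (<₂ q) = contradiction q (ℤ.<-asym p)
  ⊑-antisym (<₂ p) (≤₃ q) = contradiction p (ℤ.<-irrefl refl)
  ⊑-antisym (≤₃ p) (<₁ q) = contradiction q (ℤ.<-irrefl refl)
  ⊑-antisym (≤₃ p) (<₂ q) = contradiction q (ℤ.<-irrefl refl)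
  ⊑-antisym (≤₃ p) (≤₃ q) = cong ⟨ _ , _ ,_⟩ (ℤ.≤-antisym p q)

  ⊑-total : ∀ x y → x ⊑ y ⊎ y ⊑ x
  ⊑-total ⟨ a , b , c ⟩ ⟨ a′ , b′ , c′ ⟩ with ℤ.<-cmp a a′
  ... | tri< a<a′ _ _ = inj₁ (<₁ a<a′)
  ... | tri> _ _ a′<a = inj₂ (<₁ a′<a)
  ... | tri≈ _ refl _ with ℤ.<-cmp b b′
  ...   | tri< b<b′ _ _ = inj₁ (<₂ b<b′)
  ...   | tri> _ _ b′<b = inj₂ (<₂ b′<b)
  ...   | tri≈ _ refl _ with ℤ.≤-total c c′
  ...     | inj₁ c≤c′ = inj₁ (≤₃ c≤c′)
  ...     | inj₂ c′≤c = inj₂ (≤₃ c′≤c)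

  isTotalOrder : IsTotalOrder _≡_ _⊑_
  isTotalOrder = record
    { isPartialOrder = record
      { isPreorder = record
        { isEquivalence = isEquivalence
        ; reflexive     = λ { refl → ⊑-refl }
        ; trans         = ⊑-trans
        }
      ; antisym = ⊑-antisym
      }
    ; total = ⊑-total
    }

  ∙-monoˡ-⊑ : ∀ z {x y} → x ⊑ y → z ∙ x ⊑ z ∙ y
  ∙-monoˡ-⊑ ⟨ p , q , r ⟩ (<₁ a<a′) = <₁ (ℤ.+-monoʳ-< p a<a′)
  ∙-monoˡ-⊑ ⟨ p , q , r ⟩ (<₂ b<b′) = <₂ (ℤ.+-monoʳ-< q b<b′)
  ∙-monoˡ-⊑ ⟨ p , q , r ⟩ {⟨ a , b , c ⟩} (≤₃ c≤c′) = ≤₃ (ℤ.+-monoˡ-≤ (p * b) (ℤ.+-monoʳ-≤ r c≤c′))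

  ∙-monoʳ-⊑ : ∀ z {x y} → x ⊑ y → x ∙ z ⊑ y ∙ z
  ∙-monoʳ-⊑ ⟨ p , q , r ⟩ (<₁ a<a′) = <₁ (ℤ.+-monoˡ-< p a<a′)
  ∙-monoʳ-⊑ ⟨ p , q , r ⟩ (<₂ b<b′) = <₂ (ℤ.+-monoˡ-< q b<b′)
  ∙-monoʳ-⊑ ⟨ p , q , r ⟩ {⟨ a , b , c ⟩} (≤₃ c≤c′) = ≤₃ (ℤ.+-monoˡ-≤ (a * q) (ℤ.+-monoˡ-≤ r c≤c′))

  x₀ y₀ : H
  x₀ = ⟨ 1ℤ , 0ℤ , 0ℤ ⟩
  y₀ = ⟨ 0ℤ , 1ℤ , 0ℤ ⟩

  x₀y₀≢y₀x₀ : x₀ ∙ y₀ ≢ y₀ ∙ x₀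
  x₀y₀≢y₀x₀ ()

  open TotallyOrderedGroup isGroup isTotalOrder ∙-monoˡ-⊑ ∙-monoʳ-⊑ public

  lPregroup-¬ICommutes : ∀ m → ¬ ICommutes lPregroup (suc m)
  lPregroup-¬ICommutes = noncommutative⇒¬ICommutes x₀ y₀ x₀y₀≢y₀x₀

lemma3p10 : (c : Level) (m : ℕ) →
    ((A : LPregroup c) → Periodic A (suc m) →
      (∀ x → Invertible A x ⇔ Σ (LPregroup.Carrier A) (λ a → x ≡ i A (suc m) a))
      × (InvertiblesCommute A ⇔ ICommutes A (suc m)))
    × ICommutesF (suc m)
    × Σ (LPregroup 0ℓ) (λ A → Periodic A (suc m) × ¬ ICommutes A (suc m))
lemma3p10 c m =
  (λ A periodic → invertible⇔i-image A m periodic , invertiblesCommute⇔ICommutes A m periodic)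
  , iCommutesF m
  , (lPregroup , lPregroup-periodic (suc m) , lPregroup-¬ICommutes m)
  where
  open LPregroupProperties using (invertible⇔i-image; invertiblesCommute⇔ICommutes)
  open IntegerMaps using (iCommutesF)
  open Heisenberg
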